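{- Let $(C_0, I, O)$ be an ILP Modulo $T$ instance and consider the $\mathrm{BC}(T)$ transition system for it. For any states $\langle P, A\rangle$ and $\langle P', A'\rangle$ with $\langle P, A\rangle \longrightarrow \langle P', A'\rangle$: if there is an integer assignment $B$ that is a $T$-model of $C \wedge D \wedge I$ for some subproblem $\langle C, D\rangle \in P$, then either (i) $obj(A') \le obj(B)$, or (ii) $B$ is a $T$-model of $C' \wedge D' \wedge I$ for some subproblem $\langle C', D'\rangle \in P'$.
   Context: Fix a set $\mathcal V$ of integer variables. An integer linear constraint has the form $c_1v_1+\dots+c_nv_n \bowtie r$ with integers $c_i, r$, $v_i \in \mathcal V$, $\bowtie \in \{<,\le,=,>,\ge\}$; an integer linear formula is a finite set (conjunction) of such constraints. An integer assignment is a function $A:\mathcal V\to\mathbb Z$, identified with the set of formulas $\{v = A(v) : v\in\mathcal V\}$. $\mathcal Z$ denotes the theory of linear integer arithmetic (all first-order sentences over the signature $0,\pm1,\pm2,\dots,+,-,\le$ true in the standard model $\mathbb Z$). For a theory $T'$, a formula $F$ is $T'$-consistent if $F\wedge T'$ has a model, and $F\models_{T'} G$ means $F\wedge\neg G$ is $T'$-inconsistent. Let $T$ be a $\Sigma$-theory with $\Sigma$ disjoint from the signature of $\mathcal Z$. A $\Sigma$-interface atom is a $\Sigma$-atomic formula $t$, possibly annotated with a variable $v$ (written $t^v$), the annotation meaning $t \Leftrightarrow v>0$. An ILP Modulo $T$ instance is a triple $(C_0, I, O)$ with $C_0$ an integer linear formula, $I$ a set of $\Sigma$-interface atoms, and $O=\sum_i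 c_i v_i$ an integer linear expression to be minimized. For an assignment $A$, $obj(A)=\sum_i c_iA(v_i)$; also $obj(\mathrm{none})=+\infty$ and $obj(A^{ -\infty})=-\infty$. An assignment $A$ is a $T$-model of a formula $F$ if $A$ is $T$-consistent and $A\models_{\mathcal Z\cup T} F$. A simple equality is a constraint $v_i=c$ or $v_i-v_j=c$ ($c$ an integer constant). A subproblem is a pair $\langle C, D\rangle$ with $C$ a set of integer linear constraints and $D$ a set of simple equalities. A state is a pair $\langle P, A\rangle$ where $P$ is a set of subproblems and $A$ is either the constant $\mathrm{none}$, an assignment, or an assignment annotated with superscript $-\infty$. A fixed function $lb$ on subproblems satisfies: no assignment $A$ satisfying $C\wedge D$ has $obj(A) < lb(\langle C,D\rangle)$. Notation: $P\uplus Q$ is union of disjoint sets; $C\,c$ is $C\cup\{c\}$ with $c\notin C$ (likewise $D\,d$). The transition relation $\longrightarrow$ of $\mathrm{BC}(T)$ is given by the rules: Branch: $\langle P\uplus\{\langle C,D\rangle\}, A\rangle \longrightarrow \langle P\cup\{\langle C_i,D\rangle : 1\le i\le n\}, A\rangle$ if $n>1$, $D\models_{\mathcal Z}(C\Leftrightarrow\bigvee_{i} C_i)$, and the $C_i$ are syntactically distinct. Learn: $\langle P\uplus\{\langle C,D\rangle\},A\rangle\longrightarrow\langle P\cup\{\langle C\,c,D\rangle\},A\rangle$ if $C\wedge D\models_{\mathcal Z} c$. Forget: $\langle P\uplus\{\langle C\,c,D\rangle\},A\rangle\longrightarrow\langle P\cup\{\langle C,D\rangle\},A\rangle$ if $C\wedge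 D\models_{\mathcal Z} c$. Propagate: $\langle P\uplus\{\langle C,D\rangle\},A\rangle\longrightarrow\langle P\cup\{\langle C,D\,d\rangle\},A\rangle$ if $d$ is a simple equality and $C\wedge D\models_{\mathcal Z} d$. Drop: $\langle P\uplus\{\langle C,D\rangle\},A\rangle\longrightarrow\langle P,A\rangle$ if $C\wedge D$ has no integer solution. Prune: $\langle P\uplus\{\langle C,D\rangle\},A\rangle\longrightarrow\langle P,A\rangle$ if $A\neq\mathrm{none}$ and $lb(\langle C,D\rangle)\ge obj(A)$. Retire: $\langle P\uplus\{\langle C,D\rangle\},A\rangle\longrightarrow\langle P,A'\rangle$ if $A'$ is a $T$-model of $C\wedge D\wedge I$, $obj(A')<obj(A)$, and $obj(A')\le obj(B)$ for every $T$-model $B$ of $C\wedge D\wedge I$. Unbounded: $\langle P\uplus\{\langle C,D\rangle\},A\rangle\longrightarrow\langle \emptyset,A'^{ -\infty}\rangle$ if $A'$ is a $T$-model of $C\wedge D\wedge I$, $obj(A')\le obj(A)$, and for every $k$ there is a $T$-model $B$ of $C\wedge D\wedge I$ with $obj(B)<k$. T-Learn: $\langle P\uplus\{\langle C,D\rangle\},A\rangle\longrightarrow\langle P\cup\{\langle C\,c,D\rangle\},A\rangle$ if there is a formula $F$ with $C\wedge D\models_{\mathcal Z} F$ and $F\wedge I\models_T c$. -}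

module Defs where

open import Data.Nat using (ℕ; _≤_)
open import Data.Integer as ℤ using (ℤ; +_; -[1+_]; 0ℤ; 1ℤ; -1ℤ)
open import Data.Rational as ℚ using (ℚ; _/_)
open import Data.List using (List; []; _∷_; [_]; map; length; foldr)
open import Data.List.Membership.Propositional using (_∈_; _∉_)
open import Data.List.Relation.Unary.All using (All)
open import Data.List.Relation.Unary.Any using (Any)
open import Data.List.Relation.Unary.AllPairs using (AllPairs)
open import Data.Maybe using (Maybe; just; nothing)
open import Data.Product using (_×_; _,_; Σ; ∃; ∃-syntax)
open import Data.Sum using (_⊎_)
open import Data.Empty using (⊥)
open import Data.Unit using (⊤)
open import Function.Bundles using (_⇔_)
open import Relation.Nullary using (¬_)
open import Relation.Binary.PropositionalEquality using (_≡_)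

data Rel : Set where
  lt le eq gt ge : Rel

-- c₁v₁ + … + cₙvₙ ⋈ r, the left-hand side as a list of (cᵢ , vᵢ)
record Constraint (V : Set) : Set where
  constructor mkC
  field
    lhs : List (ℤ × V)
    rel : Rel
    rhs : ℤ

-- integer linear formula = finite set (conjunction) of constraints,
-- represented by a list (set semantics via membership)
Formula : Set → Set
Formula V = List (Constraint V)

Assignment : Set → Set
Assignment V = V → ℤ

evalLin : {V : Set} → Assignment V → List (ℤ × V) → ℤ
evalLin α = foldr (λ { (c , v) acc → c ℤ.* α v ℤ.+ acc }) 0ℤ

holdsRel : Rel → ℤ → ℤ → Set
holdsRel lt x y = x ℤ.< y
holdsRel le x y = x ℤ.≤ y
holdsRel eq x y = x ≡ y
holdsRel gt x y = x ℤ.> y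
holdsRel ge x y = x ℤ.≥ y

_⊨c_ : {V : Set} → Assignment V → Constraint V → Set
α ⊨c mkC l r k = holdsRel r (evalLin α l) k

_⊨f_ : {V : Set} → Assignment V → Formula V → Set
α ⊨f F = All (α ⊨c_) F

data SimpleEq {V : Set} : Constraint V → Set where
  single : (v : V) (c : ℤ) → SimpleEq (mkC [ (1ℤ , v) ] eq c)
  diff   : (v w : V) (c : ℤ) → SimpleEq (mkC ((1ℤ , v) ∷ (-1ℤ , w) ∷ []) eq c)

data Ext : Set where
  -∞  : Ext
  fin : ℚ → Ext
  +∞  : Ext

data _≤ₑ_ : Ext → Ext → Set where
  -∞≤     : ∀ {x} → -∞ ≤ₑ x
  ≤+∞     : ∀ {x} → x ≤ₑ +∞
  fin≤fin : ∀ {p q} → p ℚ.≤ q → fin p ≤ₑ fin q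

data _<ₑ_ : Ext → Ext → Set where
  -∞<fin  : ∀ {q} → -∞ <ₑ fin q
  -∞<+∞   : -∞ <ₑ +∞
  fin<+∞  : ∀ {q} → fin q <ₑ +∞
  fin<fin : ∀ {p q} → p ℚ.< q → fin p <ₑ fin q

toExt : ℤ → Ext
toExt z = fin (z / 1)

-- Model α : models of Z ∪ T in which every variable v equals α v
--           (i.e. models of Z ∪ T ∪ {v = α v : v ∈ V}).

record Theory (V : Set) : Set₁ where
  field
    Atom  : Set
    Model : Assignment V → Set
    Holds : {α : Assignment V} → Model α → Atom → Set

-- Σ-interface atom t, optionally annotated with a variable v (t^v)
record IAtom {V : Set} (T : Theory V) : Set where
  constructor iatom
  field
    atom : Theory.Atom T
    ann  : Maybe V

module ILPModT {V : Set} (T : Theory V) where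
  open Theory T

  HoldsI : {α : Assignment V} → Model α → IAtom T → Set
  HoldsI M (iatom t nothing)  = Holds M t
  HoldsI {α} M (iatom t (just v)) = Holds M t ⇔ (α v ℤ.> 0ℤ)

  record Instance : Set₁ where
    field
      C₀ : Formula V
      I  : List (IAtom T)
      O  : List (ℤ × V)

  -- subproblems ⟨C , D⟩ (D should consist of simple equalities)
  record Subproblem : Set where
    constructor ⟨_,_⟩
    field
      C : Formula V
      D : Formula V

  _≋_ : {X : Set} → List X → List X → Set
  xs ≋ ys = ∀ z → (z ∈ xs) ⇔ (z ∈ ys)

  _≈ₛ_ : Subproblem → Subproblem → Set
  ⟨ C , D ⟩ ≈ₛ ⟨ C' , D' ⟩ = (C ≋ C') × (D ≋ D')

  _∈ₛ_ : Subproblem → List Subproblem → Set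
  x ∈ₛ P = Any (_≈ₛ x) P

  Split : List Subproblem → List Subproblem → Subproblem → Set
  Split P P₀ x = (∀ y → (y ∈ₛ P) ⇔ ((y ∈ₛ P₀) ⊎ (y ≈ₛ x))) × ¬ (x ∈ₛ P₀)

  Join : List Subproblem → List Subproblem → List Subproblem → Set
  Join P' P₀ Q = ∀ y → (y ∈ₛ P') ⇔ ((y ∈ₛ P₀) ⊎ (y ∈ₛ Q))

  data AVal : Set where
    none : AVal
    asg  : Assignment V → AVal
    unb  : Assignment V → AVal

  State : Set
  State = List Subproblem × AVal

  module _ (inst : Instance) where
    open Instance inst

    objℤ : Assignment V → ℤ
    objℤ α = evalLin α O

    obj : AVal → Ext
    obj none    = +∞
    obj (asg α) = toExt (objℤ α)
    obj (unb α) = -∞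

    _⊨Z_ : Formula V → Constraint V → Set
    F ⊨Z c = ∀ (α : Assignment V) → α ⊨f F → α ⊨c c

    TConsistent : Assignment V → Set
    TConsistent α = Model α

    TModel : Assignment V → Subproblem → Set
    TModel α ⟨ C , D ⟩ =
      TConsistent α × α ⊨f C × α ⊨f D × (∀ (M : Model α) → All (HoldsI M) I)

    LowerBound : (Subproblem → Ext) → Set
    LowerBound lb = ∀ C D (α : Assignment V) → α ⊨f C → α ⊨f D →
                    ¬ (toExt (objℤ α) <ₑ lb ⟨ C , D ⟩)

    module Rules (lb : Subproblem → Ext) where

      data _⟶_ : State → State → Set where
        Branch : ∀ {P P' A} (P₀ : List Subproblem) (C D : Formula V)
                   (Cs : List (Formula V)) →
                 Split P P₀ ⟨ C , D ⟩ →
                 Join P' P₀ (map (λ Ci → ⟨ Ci , D ⟩) Cs) →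
                 2 ≤ length Cs →
                 AllPairs (λ Ci Cj → ¬ (Ci ≋ Cj)) Cs →
                 (∀ (α : Assignment V) → α ⊨f D →
                    (α ⊨f C) ⇔ Any (α ⊨f_) Cs) →
                 (P , A) ⟶ (P' , A)
        Learn : ∀ {P P' A} (P₀ : List Subproblem) (C D : Formula V)
                  (c : Constraint V) →
                Split P P₀ ⟨ C , D ⟩ →
                Join P' P₀ [ ⟨ c ∷ C , D ⟩ ] →
                c ∉ C →
                (C Data.List.++ D) ⊨Z c →
                (P , A) ⟶ (P' , A)
        Forget : ∀ {P P' A} (P₀ : List Subproblem) (C D : Formula V)
                   (c : Constraint V) →
                 Split P P₀ ⟨ c ∷ C , D ⟩ →
                 Join P' P₀ [ ⟨ C , D ⟩ ] →
                 c ∉ C →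
                 (C Data.List.++ D) ⊨Z c →
                 (P , A) ⟶ (P' , A)
        Propagate : ∀ {P P' A} (P₀ : List Subproblem) (C D : Formula V)
                      (d : Constraint V) →
                    Split P P₀ ⟨ C , D ⟩ →
                    Join P' P₀ [ ⟨ C , d ∷ D ⟩ ] →
                    d ∉ D →
                    SimpleEq d →
                    (C Data.List.++ D) ⊨Z d →
                    (P , A) ⟶ (P' , A)
        Drop : ∀ {P P' A} (P₀ : List Subproblem) (C D : Formula V) →
               Split P P₀ ⟨ C , D ⟩ →
               Join P' P₀ [] →
               (∀ (α : Assignment V) → ¬ (α ⊨f C × α ⊨f D)) →
               (P , A) ⟶ (P' , A)
        Prune : ∀ {P P' A} (P₀ : List Subproblem) (C D : Formula V) →
                Split P P₀ ⟨ C , D ⟩ →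
                Join P' P₀ [] →
                ¬ (A ≡ none) →
                obj A ≤ₑ lb ⟨ C , D ⟩ →
                (P , A) ⟶ (P' , A)
        Retire : ∀ {P P' A} (P₀ : List Subproblem) (C D : Formula V)
                   (A' : Assignment V) →
                 Split P P₀ ⟨ C , D ⟩ →
                 Join P' P₀ [] →
                 TModel A' ⟨ C , D ⟩ →
                 obj (asg A') <ₑ obj A →
                 (∀ B → TModel B ⟨ C , D ⟩ → obj (asg A') ≤ₑ obj (asg B)) →
                 (P , A) ⟶ (P' , asg A')
        Unbounded : ∀ {P P' A} (P₀ : List Subproblem) (C D : Formula V)
                      (A' : Assignment V) →
                    Split P P₀ ⟨ C , D ⟩ →
                    (∀ y → ¬ (y ∈ₛ P')) →
                    TModel A' ⟨ C , D ⟩ →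
                    obj (asg A') ≤ₑ obj A →
                    (∀ (k : ℤ) → ∃[ B ] (TModel B ⟨ C , D ⟩ × objℤ B ℤ.< k)) →
                    (P , A) ⟶ (P' , unb A')
        T-Learn : ∀ {P P' A} (P₀ : List Subproblem) (C D : Formula V)
                    (c : Constraint V) (F : Formula V) →
                  Split P P₀ ⟨ C , D ⟩ →
                  Join P' P₀ [ ⟨ c ∷ C , D ⟩ ] →
                  c ∉ C →
                  (∀ f → f ∈ F → (C Data.List.++ D) ⊨Z f) →
                  (∀ (α : Assignment V) (M : Model α) → α ⊨f F →
                     All (HoldsI M) I → α ⊨c c) →
                  (P , A) ⟶ (P' , A)

-- A transition removes one subproblem s from P and adds a set Q of new ones, keeping the
-- rest.  A T-model B of a subproblem other than s therefore stays in P'.  For s itself each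
-- rule is checked separately: Branch, Learn, Forget, Propagate and T-Learn rebuild B as a
-- T-model of a subproblem in Q; Drop cannot apply to a subproblem with a model; Prune and
-- Retire leave an incumbent no worse than B (by the lower bound, resp. the optimality of the
-- retired assignment); and Unbounded sets the incumbent to -∞.
module Submission where

open import Defs
open import Data.List using (List; _∷_; [_]; _++_; map)
open import Data.List.Membership.Propositional using (_∈_; find)
open import Data.List.Relation.Unary.All as All using (All; _∷_)
open import Data.List.Relation.Unary.All.Properties using (++⁺; anti-mono)
open import Data.List.Relation.Unary.Any using (Any; here; there)
open import Data.Product using (_×_; _,_; ∃-syntax)
open import Data.Sum using (_⊎_; inj₁; inj₂)
open import Data.Empty using (⊥-elim)
open import Function.Base using (_∘_)
open import Function.Bundles using (_⇔_; mk⇔; Equivalence)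
open import Relation.Nullary using (¬_)
open import Relation.Binary.PropositionalEquality using (refl)
import Data.Rational.Properties as ℚ

open Equivalence

≤ₑ-trans : ∀ {x y z} → x ≤ₑ y → y ≤ₑ z → x ≤ₑ z
≤ₑ-trans -∞≤           _             = -∞≤
≤ₑ-trans ≤+∞           ≤+∞           = ≤+∞
≤ₑ-trans (fin≤fin p≤q) ≤+∞           = ≤+∞
≤ₑ-trans (fin≤fin p≤q) (fin≤fin q≤r) = fin≤fin (ℚ.≤-trans p≤q q≤r)

fin-≮ₑ⇒≥ₑ : ∀ {q x} → ¬ (fin q <ₑ x) → x ≤ₑ fin q
fin-≮ₑ⇒≥ₑ {x = -∞}    _     = -∞≤
fin-≮ₑ⇒≥ₑ {x = fin p} q≮p   = fin≤fin (ℚ.≮⇒≥ (λ q<p → q≮p (fin<fin q<p)))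
fin-≮ₑ⇒≥ₑ {x = +∞}    q≮+∞  = ⊥-elim (q≮+∞ fin<+∞)

module Invariant {V : Set} (T : Theory V) (inst : ILPModT.Instance T) where
  open ILPModT T
  open Instance inst

  All-resp-≋ : {X : Set} {Q : X → Set} {xs ys : List X} → xs ≋ ys → All Q xs → All Q ys
  All-resp-≋ xs≋ys = anti-mono (λ {z} → from (xs≋ys z))

  ≈ₛ-refl : ∀ s → s ≈ₛ s
  ≈ₛ-refl ⟨ C , D ⟩ = (λ _ → mk⇔ (λ z → z) (λ z → z)) , (λ _ → mk⇔ (λ z → z) (λ z → z))

  ∈ₛ-map : ∀ {D Ci} (Cs : List (Formula V)) → Ci ∈ Cs →
           ⟨ Ci , D ⟩ ∈ₛ map (λ Ci → ⟨ Ci , D ⟩) Cs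
  ∈ₛ-map (_ ∷ _)  (here refl) = here (≈ₛ-refl _)
  ∈ₛ-map (_ ∷ Cs) (there Ci∈) = there (∈ₛ-map Cs Ci∈)

  TModel-resp-≈ₛ : ∀ {B x s} → x ≈ₛ s → TModel inst B x → TModel inst B s
  TModel-resp-≈ₛ {x = ⟨ _ , _ ⟩} {⟨ _ , _ ⟩} (C≋ , D≋) (mo , ⊨C , ⊨D , ⊨I) =
    mo , All-resp-≋ C≋ ⊨C , All-resp-≋ D≋ ⊨D , ⊨I

  ModelIn : List Subproblem → Assignment V → Set
  ModelIn P B = ∃[ x ] (x ∈ₛ P × TModel inst B x)

  Survives : AVal → List Subproblem → Assignment V → Set
  Survives A' P' B = (obj inst A' ≤ₑ obj inst (asg B)) ⊎ ModelIn P' B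

  ModelIn-singleton : ∀ {B} s → TModel inst B s → ModelIn [ s ] B
  ModelIn-singleton s ⊨s = s , here (≈ₛ-refl s) , ⊨s

  survives-step : ∀ {P P₀ P' Q s A' B} → Split P P₀ s → Join P' P₀ Q →
                  (TModel inst B s → Survives A' Q B) → ModelIn P B → Survives A' P' B
  survives-step (P≅ , _) P'≅ at-s (x , x∈P , ⊨x) with to (P≅ x) x∈P
  ... | inj₁ x∈P₀ = inj₂ (x , from (P'≅ x) (inj₁ x∈P₀) , ⊨x)
  ... | inj₂ x≈s with at-s (TModel-resp-≈ₛ x≈s ⊨x)
  ...   | inj₁ A'≤B              = inj₁ A'≤B
  ...   | inj₂ (y , y∈Q , ⊨y)    = inj₂ (y , from (P'≅ y) (inj₂ y∈Q) , ⊨y)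

  branch-model : ∀ {B C D} (Cs : List (Formula V)) →
                 (∀ α → α ⊨f D → (α ⊨f C) ⇔ Any (α ⊨f_) Cs) →
                 TModel inst B ⟨ C , D ⟩ → ModelIn (map (λ Ci → ⟨ Ci , D ⟩) Cs) B
  branch-model {B} Cs C⇔Cs (mo , ⊨C , ⊨D , ⊨I) with find (to (C⇔Cs B ⊨D) ⊨C)
  ... | Ci , Ci∈Cs , ⊨Ci = ⟨ Ci , _ ⟩ , ∈ₛ-map Cs Ci∈Cs , mo , ⊨Ci , ⊨D , ⊨I

  learn-model : ∀ {B C D c} → (∀ α → α ⊨f (C ++ D) → α ⊨c c) →
                TModel inst B ⟨ C , D ⟩ → TModel inst B ⟨ c ∷ C , D ⟩
  learn-model {B} C∧D⊨c (mo , ⊨C , ⊨D , ⊨I) = mo , C∧D⊨c B (++⁺ ⊨C ⊨D) ∷ ⊨C , ⊨D , ⊨I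

  forget-model : ∀ {B C D c} → TModel inst B ⟨ c ∷ C , D ⟩ → TModel inst B ⟨ C , D ⟩
  forget-model (mo , _ ∷ ⊨C , ⊨D , ⊨I) = mo , ⊨C , ⊨D , ⊨I

  propagate-model : ∀ {B C D d} → (∀ α → α ⊨f (C ++ D) → α ⊨c d) →
                    TModel inst B ⟨ C , D ⟩ → TModel inst B ⟨ C , d ∷ D ⟩
  propagate-model {B} C∧D⊨d (mo , ⊨C , ⊨D , ⊨I) = mo , ⊨C , C∧D⊨d B (++⁺ ⊨C ⊨D) ∷ ⊨D , ⊨I

  T-learn-model : ∀ {B C D c F} → (∀ f → f ∈ F → ∀ α → α ⊨f (C ++ D) → α ⊨c f) →
                  (∀ α (M : Theory.Model T α) → α ⊨f F → All (HoldsI M) I → α ⊨c c) →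
                  TModel inst B ⟨ C , D ⟩ → TModel inst B ⟨ c ∷ C , D ⟩
  T-learn-model {B} {F = F} C∧D⊨F F∧I⊨c (mo , ⊨C , ⊨D , ⊨I) =
    mo , F∧I⊨c B mo ⊨F (⊨I mo) ∷ ⊨C , ⊨D , ⊨I
    where
    ⊨F : B ⊨f F
    ⊨F = All.tabulate (λ {f} f∈F → C∧D⊨F f f∈F B (++⁺ ⊨C ⊨D))

  prune-bound : ∀ {lb A B C D} → LowerBound inst lb → obj inst A ≤ₑ lb ⟨ C , D ⟩ →
                TModel inst B ⟨ C , D ⟩ → obj inst A ≤ₑ obj inst (asg B)
  prune-bound {B = B} {C} {D} lb-sound A≤lb (_ , ⊨C , ⊨D , _) =
    ≤ₑ-trans A≤lb (fin-≮ₑ⇒≥ₑ (lb-sound C D B ⊨C ⊨D))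

lemma1 : {V : Set} (T : Theory V) (inst : ILPModT.Instance T)
    (lb : ILPModT.Subproblem T → Ext) →
    ILPModT.LowerBound T inst lb →
    ∀ {P P' : List (ILPModT.Subproblem T)} {A A' : ILPModT.AVal T} →
    ILPModT.Rules._⟶_ T inst lb (P , A) (P' , A') →
    ∀ (B : Assignment V) →
    (∃[ x ] (ILPModT._∈ₛ_ T x P × ILPModT.TModel T inst B x)) →
    (ILPModT.obj T inst A' ≤ₑ ILPModT.obj T inst (ILPModT.asg B))
    ⊎ (∃[ x' ] (ILPModT._∈ₛ_ T x' P' × ILPModT.TModel T inst B x'))
lemma1 T inst lb lb-sound step B = go step
  where
  open ILPModT.Rules T inst lb
  open Invariant T inst
  go : ∀ {P P' A A'} → (P , A) ⟶ (P' , A') → ModelIn P B → Survives A' P' B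
  go (Branch _ _ _ Cs split join _ _ C⇔Cs) =
    survives-step split join (inj₂ ∘ branch-model Cs C⇔Cs)
  go (Learn _ _ _ _ split join _ C∧D⊨c) =
    survives-step split join (inj₂ ∘ ModelIn-singleton _ ∘ learn-model C∧D⊨c)
  go (Forget _ _ _ _ split join _ _) =
    survives-step split join (inj₂ ∘ ModelIn-singleton _ ∘ forget-model)
  go (Propagate _ _ _ _ split join _ _ C∧D⊨d) =
    survives-step split join (inj₂ ∘ ModelIn-singleton _ ∘ propagate-model C∧D⊨d)
  go (Drop _ _ _ split join infeasible) =
    survives-step split join (λ (_ , ⊨C , ⊨D , _) → ⊥-elim (infeasible B (⊨C , ⊨D)))
  go (Prune _ _ _ split join _ A≤lb) =
    survives-step split join (inj₁ ∘ prune-bound lb-sound A≤lb)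
  go (Retire _ _ _ _ split join _ _ optimal) =
    survives-step split join (inj₁ ∘ optimal B)
  go (Unbounded _ _ _ _ _ _ _ _ _) _ = inj₁ -∞≤
  go (T-Learn _ _ _ _ _ split join _ C∧D⊨F F∧I⊨c) =
    survives-step split join (inj₂ ∘ ModelIn-singleton _ ∘ T-learn-model C∧D⊨F F∧I⊨c)
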